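{- Let $m\neq0$ and $r$ be real and let $\alpha_0,\alpha_1,\dots$ be real numbers. Then for all $0\le i\le n$, \[ m^{n-i}S(n,i;\overline{\alpha})=\sum_{k=i}^{n}w_{m,r;\overline{\alpha}}(n,k)\,W_{m,r}(k,i). \]
   Context: Let $(x)_k=x(x-1)\cdots(x-k+1)$, $(x)_0=1$, and for a real sequence $\overline{\alpha}=(\alpha_0,\alpha_1,\dots)$ let $(x;\overline{\alpha})_n=\prod_{i=0}^{n-1}(x-\alpha_i)$, $(x;\overline{\alpha})_0=1$. The $r$-Whitney numbers of the second kind $W_{m,r}(n,k)$ are defined by $(mx+r)^n=\sum_{k=0}^{n}W_{m,r}(n,k)m^k(x)_k$. The multiparameter Stirling numbers of the second kind $S(n,k;\overline{\alpha})$ are defined by $(x;\overline{\alpha})_n=\sum_{k=0}^{n}S(n,k;\overline{\alpha})(x)_k$. The generalized $r$-Whitney numbers of the first kind $w_{m,r;\overline{\alpha}}(n,k)$ are defined by $m^n(x;\overline{\alpha})_n=\sum_{k=0}^{n}w_{m,r;\overline{\alpha}}(n,k)(mx+r)^k$. All identities are polynomial identities in $x$. -}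

module Defs where

open import Level using (Level; _⊔_)
open import Data.Nat as ℕ using (ℕ; zero; suc)
open import Relation.Nullary using (¬_)
open import Data.Product using (Σ-syntax)
open import Algebra.Bundles using (CommutativeRing)

ringFromℕ : {c ℓ : Level} (R : CommutativeRing c ℓ) → ℕ → CommutativeRing.Carrier R
ringFromℕ R zero    = CommutativeRing.0# R
ringFromℕ R (suc n) = CommutativeRing._+_ R (CommutativeRing.1# R) (ringFromℕ R n)

-- A field of characteristic zero (stdlib 2.3 has no Field bundle and no reals;
-- ℝ is an instance of this record).
record Char0Field (c ℓ : Level) : Set (Level.suc (c ⊔ ℓ)) where
  field
    commutativeRing : CommutativeRing c ℓ
  open CommutativeRing commutativeRing public
  field
    1≉0     : ¬ (1# ≈ 0#)
    inverse : ∀ x → ¬ (x ≈ 0#) → Σ[ y ∈ Carrier ] (x * y ≈ 1#)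
    char0   : ∀ n → ¬ (ringFromℕ commutativeRing (suc n) ≈ 0#)

module FieldDefs {c ℓ : Level} (F : Char0Field c ℓ) where
  open Char0Field F

  fromℕ : ℕ → Carrier
  fromℕ = ringFromℕ commutativeRing

  pow : Carrier → ℕ → Carrier
  pow x zero    = 1#
  pow x (suc n) = pow x n * x

  sumTo : ℕ → (ℕ → Carrier) → Carrier
  sumTo zero    f = f 0
  sumTo (suc n) f = sumTo n f + f (suc n)

  -- Σ_{k=i}^{n} f k  (used only with i ≤ n) : Σ_{j=0}^{n-i} f (i + j)
  sumFromTo : ℕ → ℕ → (ℕ → Carrier) → Carrier
  sumFromTo i n f = sumTo (n ℕ.∸ i) (λ j → f (i ℕ.+ j))

  falling : Carrier → ℕ → Carrier
  falling x zero    = 1#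
  falling x (suc k) = falling x k * (x - fromℕ k)

  gfalling : (ℕ → Carrier) → Carrier → ℕ → Carrier
  gfalling α x zero    = 1#
  gfalling α x (suc n) = gfalling α x n * (x - α n)

  IsRWhitney2 : Carrier → Carrier → (ℕ → ℕ → Carrier) → Set (c ⊔ ℓ)
  IsRWhitney2 m r W = ∀ n x →
    pow (m * x + r) n ≈ sumTo n (λ k → W n k * pow m k * falling x k)

  IsMultiStirling2 : (ℕ → Carrier) → (ℕ → ℕ → Carrier) → Set (c ⊔ ℓ)
  IsMultiStirling2 α S = ∀ n x →
    gfalling α x n ≈ sumTo n (λ k → S n k * falling x k)

  IsGenRWhitney1 : Carrier → Carrier → (ℕ → Carrier) → (ℕ → ℕ → Carrier) → Set (c ⊔ ℓ)
  IsGenRWhitney1 m r α w = ∀ n x →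
    pow m n * gfalling α x n ≈ sumTo n (λ k → w n k * pow (m * x + r) k)

-- Both sides are coefficients of m^n (x;α)_n in the basis m^i (x)_i: expanding
-- (x;α)_n by S gives the left side, while expanding it by w in powers of mx+r and
-- then each power by W gives the right side after exchanging the two sums. The
-- falling factorials are linearly independent over a field of characteristic
-- zero (evaluate at x = 0, 1, 2, ...), so the coefficients agree, and m^i ≉ 0
-- can be cancelled.

module Submission where

open import Defs
open import Level using (Level)
open import Data.Nat as ℕ using (ℕ; zero; suc; _≤_; _<_; _∸_; z≤n; s≤s)
import Data.Nat.Properties as ℕₚ
open import Data.Nat.Induction using (<-rec)
open import Data.Sum using (inj₁; inj₂)
open import Data.Product using (_,_)
open import Relation.Nullary using (¬_)
open import Relation.Binary.PropositionalEquality as ≡ using (_≡_; _≢_)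
open import Relation.Binary.Definitions using (tri<; tri≈; tri>)
open import Data.Empty using (⊥-elim)
import Algebra.Properties.Ring as RingProperties
import Algebra.Properties.AbelianGroup as AbelianGroupProperties
import Algebra.Properties.CommutativeSemigroup as CommutativeSemigroupProperties
import Relation.Binary.Reasoning.Setoid as SetoidReasoning

module _ {c ℓ : Level} (F : Char0Field c ℓ) where
  open Char0Field F hiding (zero)
  open FieldDefs F
  open SetoidReasoning setoid
  open RingProperties ring using (-‿distribˡ-*)
  open AbelianGroupProperties +-abelianGroup using (⁻¹-∙-comm; x∙y⁻¹≈ε⇒x≈y)
  open CommutativeSemigroupProperties +-commutativeSemigroup using (interchange)

  *-cancelʳ : ∀ {a b z} → ¬ (z ≈ 0#) → a * z ≈ b * z → a ≈ b
  *-cancelʳ {a} {b} {z} z≉0 az≈bz with inverse z z≉0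
  ... | z⁻¹ , zz⁻¹≈1 = begin
    a             ≈⟨ sym (*-identityʳ a) ⟩
    a * 1#        ≈⟨ *-congˡ (sym zz⁻¹≈1) ⟩
    a * (z * z⁻¹) ≈⟨ sym (*-assoc a z z⁻¹) ⟩
    (a * z) * z⁻¹ ≈⟨ *-congʳ az≈bz ⟩
    (b * z) * z⁻¹ ≈⟨ *-assoc b z z⁻¹ ⟩
    b * (z * z⁻¹) ≈⟨ *-congˡ zz⁻¹≈1 ⟩
    b * 1#        ≈⟨ *-identityʳ b ⟩
    b             ∎

  *≈0⇒≈0 : ∀ {a b} → ¬ (b ≈ 0#) → a * b ≈ 0# → a ≈ 0#
  *≈0⇒≈0 {a} {b} b≉0 ab≈0 = *-cancelʳ b≉0 (trans ab≈0 (sym (zeroˡ b)))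

  *-≉0 : ∀ {a b} → ¬ (a ≈ 0#) → ¬ (b ≈ 0#) → ¬ (a * b ≈ 0#)
  *-≉0 a≉0 b≉0 ab≈0 = a≉0 (*≈0⇒≈0 b≉0 ab≈0)

  pow-≉0 : ∀ {x} → ¬ (x ≈ 0#) → ∀ n → ¬ (pow x n ≈ 0#)
  pow-≉0 x≉0 zero    = 1≉0
  pow-≉0 x≉0 (suc n) = *-≉0 (pow-≉0 x≉0 n) x≉0

  pow-+ : ∀ x a b → pow x (a ℕ.+ b) ≈ pow x b * pow x a
  pow-+ x zero    b = sym (*-identityʳ (pow x b))
  pow-+ x (suc a) b = begin
    pow x (a ℕ.+ b) * x       ≈⟨ *-congʳ (pow-+ x a b) ⟩
    (pow x b * pow x a) * x   ≈⟨ *-assoc (pow x b) (pow x a) x ⟩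
    pow x b * (pow x a * x)   ∎

  fromℕ-+ : ∀ a b → fromℕ (a ℕ.+ b) ≈ fromℕ a + fromℕ b
  fromℕ-+ zero    b = sym (+-identityˡ (fromℕ b))
  fromℕ-+ (suc a) b = trans (+-congˡ (fromℕ-+ a b)) (sym (+-assoc 1# (fromℕ a) (fromℕ b)))

  fromℕ-+-minus : ∀ a b → fromℕ (a ℕ.+ b) - fromℕ a ≈ fromℕ b
  fromℕ-+-minus a b = begin
    fromℕ (a ℕ.+ b) - fromℕ a     ≈⟨ +-congʳ (trans (fromℕ-+ a b) (+-comm (fromℕ a) (fromℕ b))) ⟩
    (fromℕ b + fromℕ a) - fromℕ a ≈⟨ +-assoc (fromℕ b) (fromℕ a) (- fromℕ a) ⟩
    fromℕ b + (fromℕ a - fromℕ a) ≈⟨ +-congˡ (-‿inverseʳ (fromℕ a)) ⟩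
    fromℕ b + 0#                  ≈⟨ +-identityʳ (fromℕ b) ⟩
    fromℕ b                       ∎

  fromℕ-<⇒difference-≉0 : ∀ {a b} → a < b → ¬ (fromℕ b - fromℕ a ≈ 0#)
  fromℕ-<⇒difference-≉0 {a} {b} a<b b-a≈0 = char0 d (begin
    fromℕ (suc d)                 ≈⟨ sym (fromℕ-+-minus a (suc d)) ⟩
    fromℕ (a ℕ.+ suc d) - fromℕ a ≈⟨ +-congʳ (reflexive (≡.cong fromℕ a+1+d≡b)) ⟩
    fromℕ b - fromℕ a             ≈⟨ b-a≈0 ⟩
    0#                            ∎)
    where
    d = b ∸ suc a
    a+1+d≡b : a ℕ.+ suc d ≡ b
    a+1+d≡b = ≡.trans (ℕₚ.+-suc a d) (ℕₚ.m+[n∸m]≡n a<b)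

  falling-fromℕ-vanishes : ∀ {j k} → j < k → falling (fromℕ j) k ≈ 0#
  falling-fromℕ-vanishes {j} {suc k} (s≤s j≤k) with ℕₚ.m≤n⇒m<n∨m≡n j≤k
  ... | inj₁ j<k    = trans (*-congʳ (falling-fromℕ-vanishes j<k)) (zeroˡ _)
  ... | inj₂ ≡.refl = trans (*-congˡ (-‿inverseʳ (fromℕ j))) (zeroʳ _)

  falling-fromℕ-≉0 : ∀ {j k} → k ≤ j → ¬ (falling (fromℕ j) k ≈ 0#)
  falling-fromℕ-≉0 {j} {zero}  _   = 1≉0
  falling-fromℕ-≉0 {j} {suc k} k<j =
    *-≉0 (falling-fromℕ-≉0 (ℕₚ.<⇒≤ k<j)) (fromℕ-<⇒difference-≉0 k<j)

  sumTo-cong : ∀ n {f g} → (∀ k → k ≤ n → f k ≈ g k) → sumTo n f ≈ sumTo n g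
  sumTo-cong zero    f≈g = f≈g 0 z≤n
  sumTo-cong (suc n) f≈g =
    +-cong (sumTo-cong n (λ k k≤n → f≈g k (ℕₚ.m≤n⇒m≤1+n k≤n))) (f≈g (suc n) ℕₚ.≤-refl)

  sumTo-zero : ∀ n {f} → (∀ k → k ≤ n → f k ≈ 0#) → sumTo n f ≈ 0#
  sumTo-zero zero    f≈0 = f≈0 0 z≤n
  sumTo-zero (suc n) f≈0 = trans
    (+-cong (sumTo-zero n (λ k k≤n → f≈0 k (ℕₚ.m≤n⇒m≤1+n k≤n))) (f≈0 (suc n) ℕₚ.≤-refl))
    (+-identityˡ 0#)

  sumTo-single : ∀ n j {f} → j ≤ n → (∀ k → k ≤ n → k ≢ j → f k ≈ 0#) → sumTo n f ≈ f j
  sumTo-single zero    zero    _     _   = refl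
  sumTo-single (suc n) j {f} j≤1+n off with ℕₚ.m≤n⇒m<n∨m≡n j≤1+n
  ... | inj₁ (s≤s j≤n) = begin
    sumTo n f + f (suc n) ≈⟨ +-cong (sumTo-single n j j≤n (λ k k≤n → off k (ℕₚ.m≤n⇒m≤1+n k≤n)))
                                    (off (suc n) ℕₚ.≤-refl (λ { ≡.refl → ℕₚ.<-irrefl ≡.refl (s≤s j≤n) })) ⟩
    f j + 0#              ≈⟨ +-identityʳ (f j) ⟩
    f j                   ∎
  ... | inj₂ ≡.refl = begin
    sumTo n f + f (suc n) ≈⟨ +-congʳ (sumTo-zero n (λ k k≤n → off k (ℕₚ.m≤n⇒m≤1+n k≤n)
                                                         (λ { ≡.refl → ℕₚ.<-irrefl ≡.refl (s≤s k≤n) }))) ⟩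
    0# + f (suc n)        ≈⟨ +-identityˡ (f (suc n)) ⟩
    f (suc n)             ∎

  sumTo-+ : ∀ n f g → sumTo n (λ k → f k + g k) ≈ sumTo n f + sumTo n g
  sumTo-+ zero    f g = refl
  sumTo-+ (suc n) f g = trans (+-congʳ (sumTo-+ n f g)) (interchange _ _ _ _)

  sumTo-- : ∀ n f g → sumTo n (λ k → f k - g k) ≈ sumTo n f - sumTo n g
  sumTo-- zero    f g = refl
  sumTo-- (suc n) f g = begin
    sumTo n (λ k → f k - g k) + (f (suc n) - g (suc n))   ≈⟨ +-congʳ (sumTo-- n f g) ⟩
    (sumTo n f - sumTo n g) + (f (suc n) - g (suc n))     ≈⟨ interchange _ _ _ _ ⟩
    (sumTo n f + f (suc n)) + (- sumTo n g - g (suc n))   ≈⟨ +-congˡ (⁻¹-∙-comm _ _) ⟩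
    (sumTo n f + f (suc n)) - (sumTo n g + g (suc n))     ∎

  *-sumTo : ∀ n a f → a * sumTo n f ≈ sumTo n (λ k → a * f k)
  *-sumTo zero    a f = refl
  *-sumTo (suc n) a f = trans (distribˡ a _ _) (+-congʳ (*-sumTo n a f))

  sumTo-* : ∀ n a f → sumTo n f * a ≈ sumTo n (λ k → f k * a)
  sumTo-* zero    a f = refl
  sumTo-* (suc n) a f = trans (distribʳ a _ _) (+-congʳ (sumTo-* n a f))

  sumFromTo-self : ∀ n f → sumFromTo n n f ≈ f n
  sumFromTo-self n f rewrite ℕₚ.n∸n≡0 n = reflexive (≡.cong f (ℕₚ.+-identityʳ n))

  sumFromTo-suc : ∀ {i n} f → i ≤ n → sumFromTo i (suc n) f ≈ sumFromTo i n f + f (suc n)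
  sumFromTo-suc {i} {n} f i≤n rewrite ℕₚ.+-∸-assoc 1 i≤n =
    +-congˡ (reflexive (≡.cong f (≡.trans (ℕₚ.+-suc i (n ∸ i)) (≡.cong suc (ℕₚ.m+[n∸m]≡n i≤n)))))

  sumTo-triangle : ∀ n (t : ℕ → ℕ → Carrier) →
    sumTo n (λ k → sumTo k (t k)) ≈ sumTo n (λ j → sumFromTo j n (λ k → t k j))
  sumTo-triangle zero    t = refl
  sumTo-triangle (suc n) t = begin
    sumTo n (λ k → sumTo k (t k)) + (sumTo n (t (suc n)) + t (suc n) (suc n))
      ≈⟨ +-congʳ (sumTo-triangle n t) ⟩
    column n + (sumTo n (t (suc n)) + t (suc n) (suc n))
      ≈⟨ sym (+-assoc _ _ _) ⟩
    (column n + sumTo n (t (suc n))) + t (suc n) (suc n)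
      ≈⟨ +-congʳ (sym (sumTo-+ n _ _)) ⟩
    sumTo n (λ j → sumFromTo j n (λ k → t k j) + t (suc n) j) + t (suc n) (suc n)
      ≈⟨ +-cong (sumTo-cong n (λ j j≤n → sym (sumFromTo-suc (λ k → t k j) j≤n)))
                (sym (sumFromTo-self (suc n) (λ k → t k (suc n)))) ⟩
    column (suc n) ∎
    where
    column : ℕ → Carrier
    column p = sumTo p (λ j → sumFromTo j p (λ k → t k j))

  fallingBasis-zero-coefficients : ∀ n (e : ℕ → Carrier) →
    (∀ x → sumTo n (λ k → e k * falling x k) ≈ 0#) → ∀ j → j ≤ n → e j ≈ 0#
  fallingBasis-zero-coefficients n e sum≈0 = <-rec (λ j → j ≤ n → e j ≈ 0#) step
    where
    step : ∀ j → (∀ {k} → k < j → k ≤ n → e k ≈ 0#) → j ≤ n → e j ≈ 0#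
    step j ih j≤n = *≈0⇒≈0 (falling-fromℕ-≉0 {j} ℕₚ.≤-refl) (begin
      e j * falling (fromℕ j) j                    ≈⟨ sym (sumTo-single n j j≤n off) ⟩
      sumTo n (λ k → e k * falling (fromℕ j) k)    ≈⟨ sum≈0 (fromℕ j) ⟩
      0#                                           ∎)
      where
      off : ∀ k → k ≤ n → k ≢ j → e k * falling (fromℕ j) k ≈ 0#
      off k k≤n k≢j with ℕₚ.<-cmp k j
      ... | tri< k<j _ _ = trans (*-congʳ (ih k<j k≤n)) (zeroˡ _)
      ... | tri≈ _ k≡j _ = ⊥-elim (k≢j k≡j)
      ... | tri> _ _ j<k = trans (*-congˡ (falling-fromℕ-vanishes j<k)) (zeroʳ _)

  fallingBasis-coefficients-unique : ∀ n (a b : ℕ → Carrier) →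
    (∀ x → sumTo n (λ k → a k * falling x k) ≈ sumTo n (λ k → b k * falling x k)) →
    ∀ j → j ≤ n → a j ≈ b j
  fallingBasis-coefficients-unique n a b a≈b j j≤n =
    x∙y⁻¹≈ε⇒x≈y (a j) (b j) (fallingBasis-zero-coefficients n (λ k → a k - b k) difference≈0 j j≤n)
    where
    difference≈0 : ∀ x → sumTo n (λ k → (a k - b k) * falling x k) ≈ 0#
    difference≈0 x = begin
      sumTo n (λ k → (a k - b k) * falling x k)
        ≈⟨ sumTo-cong n (λ k _ → trans (distribʳ _ _ _) (+-congˡ (sym (-‿distribˡ-* _ _)))) ⟩
      sumTo n (λ k → a k * falling x k - b k * falling x k)
        ≈⟨ sumTo-- n _ _ ⟩
      sumTo n (λ k → a k * falling x k) - sumTo n (λ k → b k * falling x k)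
        ≈⟨ +-congˡ (-‿cong (sym (a≈b x))) ⟩
      sumTo n (λ k → a k * falling x k) - sumTo n (λ k → a k * falling x k)
        ≈⟨ -‿inverseʳ _ ⟩
      0# ∎

  module _ (m r : Carrier) (α : ℕ → Carrier) (W S w : ℕ → ℕ → Carrier)
           (isW : IsRWhitney2 m r W) (isS : IsMultiStirling2 α S) (isw : IsGenRWhitney1 m r α w)
           (n : ℕ) where

    T : ℕ → Carrier
    T j = sumFromTo j n (λ k → w n k * W k j)

    expansion-via-Stirling : ∀ x →
      pow m n * gfalling α x n ≈ sumTo n (λ j → (pow m n * S n j) * falling x j)
    expansion-via-Stirling x = begin
      pow m n * gfalling α x n                          ≈⟨ *-congˡ (isS n x) ⟩
      pow m n * sumTo n (λ j → S n j * falling x j)     ≈⟨ *-sumTo n _ _ ⟩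
      sumTo n (λ j → pow m n * (S n j * falling x j))   ≈⟨ sumTo-cong n (λ j _ → sym (*-assoc _ _ _)) ⟩
      sumTo n (λ j → (pow m n * S n j) * falling x j)   ∎

    expansion-via-Whitney : ∀ x →
      pow m n * gfalling α x n ≈ sumTo n (λ j → (T j * pow m j) * falling x j)
    expansion-via-Whitney x = begin
      pow m n * gfalling α x n
        ≈⟨ isw n x ⟩
      sumTo n (λ k → w n k * pow (m * x + r) k)
        ≈⟨ sumTo-cong n (λ k _ → trans (*-congˡ (isW k x)) (*-sumTo k _ _)) ⟩
      sumTo n (λ k → sumTo k (λ j → w n k * (W k j * pow m j * falling x j)))
        ≈⟨ sumTo-triangle n _ ⟩
      sumTo n (λ j → sumFromTo j n (λ k → w n k * (W k j * pow m j * falling x j)))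
        ≈⟨ sumTo-cong n (λ j _ → sumTo-cong (n ∸ j) (λ l _ → reassociate _ _ _ _)) ⟩
      sumTo n (λ j → sumFromTo j n (λ k → (w n k * W k j) * (pow m j * falling x j)))
        ≈⟨ sumTo-cong n (λ j _ → sym (sumTo-* (n ∸ j) _ (λ l → w n (j ℕ.+ l) * W (j ℕ.+ l) j))) ⟩
      sumTo n (λ j → T j * (pow m j * falling x j))
        ≈⟨ sumTo-cong n (λ j _ → sym (*-assoc _ _ _)) ⟩
      sumTo n (λ j → (T j * pow m j) * falling x j) ∎
      where
      reassociate : ∀ a b p q → a * (b * p * q) ≈ (a * b) * (p * q)
      reassociate a b p q = trans (*-congˡ (*-assoc b p q)) (sym (*-assoc a b (p * q)))

    Stirling-via-Whitney : ∀ i → i ≤ n →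
      pow m n * S n i ≈ sumFromTo i n (λ k → w n k * W k i) * pow m i
    Stirling-via-Whitney = fallingBasis-coefficients-unique n _ _
      (λ x → trans (sym (expansion-via-Stirling x)) (expansion-via-Whitney x))

mainTheorem10 : {c ℓ : Level} (F : Char0Field c ℓ) →
    let open Char0Field F in
    let open FieldDefs F in
    (m r : Carrier) (α : ℕ → Carrier) (W S w : ℕ → ℕ → Carrier) →
    ¬ (m ≈ 0#) →
    IsRWhitney2 m r W → IsMultiStirling2 α S → IsGenRWhitney1 m r α w →
    ∀ n i → i ≤ n →
    pow m (n ∸ i) * S n i ≈ sumFromTo i n (λ k → w n k * W k i)
mainTheorem10 F m r α W S w m≉0 isW isS isw n i i≤n =
  *-cancelʳ F (pow-≉0 F m≉0 i) (begin
    pow m (n ∸ i) * S n i * pow m i   ≈⟨ *-comm _ (pow m i) ⟩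
    pow m i * (pow m (n ∸ i) * S n i) ≈⟨ sym (*-assoc _ _ _) ⟩
    pow m i * pow m (n ∸ i) * S n i   ≈⟨ *-congʳ (sym (pow-+ F m (n ∸ i) i)) ⟩
    pow m (n ∸ i ℕ.+ i) * S n i       ≈⟨ *-congʳ (reflexive (≡.cong (pow m) (ℕₚ.m∸n+n≡m i≤n))) ⟩
    pow m n * S n i                   ≈⟨ Stirling-via-Whitney F m r α W S w isW isS isw n i i≤n ⟩
    sumFromTo i n (λ k → w n k * W k i) * pow m i ∎)
  where
  open Char0Field F
  open FieldDefs F
  open SetoidReasoning setoid
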